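{- Let $T_1$ be a tree with $|V(T_1)|\ge 3$, let $p\ge 2$, and let $T=T_1\circ K_{1,p}$ be a tree obtained from $T_1$ and the star $K_{1,p}$ by identifying a degree-one vertex of $K_{1,p}$ with some vertex $w\in B(T_1)$. Then: (a) if $p<sp(T_1)=\Delta(T_1)$, then $sp(T)\neq\Delta(T)$; (b) if $p\le sp(T_1)<\Delta(T_1)$, then $sp(T)\neq\Delta(T)$; (c) if $sp(T_1)<p$, then $sp(T)\neq\Delta(T)$; (d) if $p=sp(T_1)=\Delta(T_1)$, then $sp(T)=\Delta(T)$.
   Context: For a tree $T_1$, $\Delta(T_1)$ is its maximum degree and $B(T_1)=\{v\in V(T_1): d_{T_1}(v)<\Delta(T_1)\}$. For a graph $G$ without isolated vertices, $sp(G)$ is the least integer $k$ such that $G$ has a subgraph $H$ with $V(H)=V(G)$ and $1\le d_H(x)\le k$ for all vertices $x$ (equivalently, the least $k$ such that $G$ has a $k$-edge-colorable subgraph in which every vertex has degree at least $1$). -}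

module Defs where

open import Data.Nat using (ℕ; zero; suc; _+_; _≤_; _<_; _⊔_)
open import Data.Bool using (Bool; true; false; if_then_else_)
open import Data.Fin using (Fin; zero; suc; splitAt)
open import Data.Fin.Properties using (_≟_)
open import Data.List using (List; []; _∷_; _++_; [_]; length; map; foldr; allFin)
open import Data.Nat.ListAction using (sum)
open import Data.List.Relation.Unary.Unique.Propositional using (Unique)
open import Data.List.Relation.Unary.Linked using (Linked)
open import Data.Sum using (_⊎_; inj₁; inj₂)
open import Data.Product using (_×_; Σ)
open import Relation.Nullary using (¬_; yes; no)
open import Relation.Binary.PropositionalEquality using (_≡_)

Adj : ℕ → Set
Adj n = Fin n → Fin n → Bool

IsSimple : ∀ {n} → Adj n → Set
IsSimple {n} A = (∀ (i j : Fin n) → A i j ≡ A j i) × (∀ (i : Fin n) → A i i ≡ false)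

deg : ∀ {n} → Adj n → Fin n → ℕ
deg {n} A v = sum (map (λ u → if A v u then 1 else 0) (allFin n))

maxDeg : ∀ {n} → Adj n → ℕ
maxDeg {n} A = foldr _⊔_ 0 (map (deg A) (allFin n))

data Walk {n} (A : Adj n) : Fin n → Fin n → Set where
  here : ∀ {u} → Walk A u u
  step : ∀ {u v w} → A u v ≡ true → Walk A v w → Walk A u w

Connected : ∀ {n} → Adj n → Set
Connected {n} A = ∀ (u v : Fin n) → Walk A u v

IsCycle : ∀ {n} → Adj n → Fin n → List (Fin n) → Set
IsCycle A v0 vs =
  Unique (v0 ∷ vs) × (2 ≤ length vs) × Linked (λ x y → A x y ≡ true) (v0 ∷ vs ++ [ v0 ])

Acyclic : ∀ {n} → Adj n → Set
Acyclic {n} A = ∀ (v0 : Fin n) (vs : List (Fin n)) → ¬ IsCycle A v0 vs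

IsTree : ∀ {n} → Adj n → Set
IsTree A = IsSimple A × Connected A × Acyclic A

InB : ∀ {n} → Adj n → Fin n → Set
InB A v = deg A v < maxDeg A

IsSpanningSubgraph : ∀ {n} → Adj n → Adj n → Set
IsSpanningSubgraph {n} H G =
  (∀ (i j : Fin n) → H i j ≡ H j i) × (∀ (i j : Fin n) → H i j ≡ true → G i j ≡ true)

Admissible : ∀ {n} → Adj n → ℕ → Set
Admissible {n} G k = Σ (Adj n) λ H → IsSpanningSubgraph H G × (∀ (x : Fin n) → 1 ≤ deg H x × deg H x ≤ k)

IsSp : ∀ {n} → Adj n → ℕ → Set
IsSp G s = Admissible G s × (∀ k → Admissible G k → s ≤ k)

-- The star K_{1,p} attached to T1 at w.  New vertices Fin p: zero is the centre c,
-- suc j (j : Fin (p-1)) are the p-1 remaining leaves; the p-th leaf of the star is w.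
private
  eqB : ∀ {n} → Fin n → Fin n → Bool
  eqB i j with i ≟ j
  ... | yes _ = true
  ... | no _ = false

attachAdj : ∀ {n p} → Adj n → Fin n → (Fin n ⊎ Fin p) → (Fin n ⊎ Fin p) → Bool
attachAdj A w (inj₁ i) (inj₁ j) = A i j
attachAdj A w (inj₁ i) (inj₂ zero) = eqB i w
attachAdj A w (inj₂ zero) (inj₁ j) = eqB j w
attachAdj A w (inj₂ zero) (inj₂ (suc _)) = true
attachAdj A w (inj₂ (suc _)) (inj₂ zero) = true
attachAdj A w _ _ = false

attachStar : ∀ {n} → Adj n → Fin n → (p : ℕ) → Adj (n + p)
attachStar {n} A w p x y = attachAdj {n} {p} A w (splitAt n x) (splitAt n y)

module Submission where

-- Since d(w) < Δ(T₁), adding the edge c–w keeps d(w) ≤ Δ(T₁), so Δ(T) = max(Δ(T₁), p).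
-- Three constructions on spanning subgraphs with all degrees in [1, k] ("admissible") do
-- the rest:
--  (1) an admissible subgraph of T₁ plus the p − 1 edges from c to the new leaves shows
--      sp(T) ≤ max(sp(T₁), p − 1); this gives (c) and the upper bound in (d);
--  (2) if p < Δ(T₁), the greedy leaves-first star cover of a breadth-first spanning tree of
--      T₁ rooted at w has degrees ≤ Δ(T₁) − 1 and covers all vertices but possibly w; adding
--      the star (and c–w if w is uncovered) gives sp(T) < Δ(T₁) ≤ Δ(T): parts (a) and (b);
--  (3) an admissible subgraph of T either keeps c–w, and then c has degree p, or restricts
--      to one of T₁; so sp(T) ≥ min(sp(T₁), p), the lower bound in (d).

open import Defs
open import Data.Nat using (ℕ; zero; suc; pred; _+_; _∸_; _≤_; _<_; _⊔_; z≤n; s≤s; >-nonZero)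
open import Data.Nat.Properties hiding (_≟_)
open import Data.Bool using (Bool; true; false; if_then_else_; _∧_; _∨_; not)
open import Data.Bool.Properties using (∧-zeroʳ; ∨-comm) renaming (_≟_ to _≟ᵇ_)
open import Data.Fin using (Fin; zero; suc; _↑ˡ_; _↑ʳ_; splitAt; join)
open import Data.Fin.Properties using (_≟_; any?; splitAt-join; join-splitAt)
open import Data.List using (tabulate; foldr)
open import Data.List.Properties using (map-tabulate)
import Data.Nat.ListAction as ListAction
open import Data.Product using (_×_; Σ; ∃; _,_; proj₁; proj₂)
open import Data.Sum using (_⊎_; inj₁; inj₂; [_,_]′)
open import Data.Empty using (⊥; ⊥-elim)
open import Relation.Nullary using (¬_; Dec; yes; no; does)
open import Relation.Nullary.Decidable using (dec-true; dec-false)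
open import Relation.Binary.PropositionalEquality
open import Function using (_∘_; id)
open import Algebra.Properties.CommutativeMonoid.Sum +-0-commutativeMonoid
  using (sum; sum-cong-≗; sum-replicate-zero; ∑-distrib-+)

true≢false : true ≢ false
true≢false ()

ind : Bool → ℕ
ind b = if b then 1 else 0

ind-∨ : ∀ a b → (a ≡ true → b ≡ true → ⊥) → ind (a ∨ b) ≡ ind a + ind b
ind-∨ true  true  excl = ⊥-elim (excl refl refl)
ind-∨ true  false excl = refl
ind-∨ false b     excl = refl

ind-mono : ∀ {a b} → (a ≡ true → b ≡ true) → ind a ≤ ind b
ind-mono {false} a→b = z≤n
ind-mono {true}  a→b rewrite a→b refl = ≤-refl

∧-elim : ∀ {a b} → a ∧ b ≡ true → a ≡ true × b ≡ true
∧-elim {true} {true} _ = refl , refl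

witness : ∀ {ℓ} {P : Set ℓ} (P? : Dec P) → does P? ≡ true → P
witness (yes p) _ = p

refutation : ∀ {ℓ} {P : Set ℓ} (P? : Dec P) → does P? ≡ false → ¬ P
refutation (no ¬p) _ = ¬p

_==_ : ∀ {n} → Fin n → Fin n → Bool
i == j = does (i ≟ j)

==-refl : ∀ {n} (i : Fin n) → i == i ≡ true
==-refl i = dec-true (i ≟ i) refl

==-sym : ∀ {n} (i j : Fin n) → i == j ≡ j == i
==-sym i j with i ≟ j | j ≟ i
... | yes _   | yes _   = refl
... | no _    | no _    = refl
... | yes i≡j | no j≢i  = ⊥-elim (j≢i (sym i≡j))
... | no i≢j  | yes j≡i = ⊥-elim (i≢j (sym j≡i))

unequal : ∀ {n} {i j : Fin n} → not (i == j) ≡ true → i ≢ j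
unequal {i = i} {j} ne with i ≟ j
unequal () | yes _
unequal _  | no i≢j = i≢j

anyᵇ : ∀ {n} → (Fin n → Bool) → Bool
anyᵇ f = does (any? (λ i → f i ≟ᵇ true))

anyᵇ-intro : ∀ {n} (f : Fin n → Bool) i → f i ≡ true → anyᵇ f ≡ true
anyᵇ-intro f i fi = dec-true (any? (λ i → f i ≟ᵇ true)) (i , fi)

anyᵇ-elim : ∀ {n} (f : Fin n → Bool) → anyᵇ f ≡ true → ∃ λ i → f i ≡ true
anyᵇ-elim f = witness (any? (λ i → f i ≟ᵇ true))

anyᵇ-none : ∀ {n} (f : Fin n → Bool) → anyᵇ f ≡ false → ∀ i → f i ≡ false
anyᵇ-none f none i with f i in fi
... | false = refl
... | true  = ⊥-elim (refutation (any? (λ i → f i ≟ᵇ true)) none (i , fi))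

anyᵇ-transfer : ∀ {n} (f g : Fin n → Bool) → (∀ i → f i ≡ g i) → anyᵇ f ≡ true → anyᵇ g ≡ true
anyᵇ-transfer f g f≗g some = let i , fi = anyᵇ-elim f some in anyᵇ-intro g i (trans (sym (f≗g i)) fi)

anyᵇ-cong : ∀ {n} {f g : Fin n → Bool} → (∀ i → f i ≡ g i) → anyᵇ f ≡ anyᵇ g
anyᵇ-cong {f = f} {g} f≗g with anyᵇ f in some-f | anyᵇ g in some-g
... | true  | true  = refl
... | false | false = refl
... | true  | false = ⊥-elim (true≢false (trans (sym (anyᵇ-transfer f g f≗g some-f)) some-g))
... | false | true  = ⊥-elim (true≢false (trans (sym (anyᵇ-transfer g f (sym ∘ f≗g) some-g)) some-f))

∑-mono : ∀ {n} {f g : Fin n → ℕ} → (∀ i → f i ≤ g i) → sum f ≤ sum g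
∑-mono {zero}  f≤g = z≤n
∑-mono {suc n} f≤g = +-mono-≤ (f≤g zero) (∑-mono (f≤g ∘ suc))

term≤∑ : ∀ {n} (f : Fin n → ℕ) i → f i ≤ sum f
term≤∑ f zero    = m≤m+n _ _
term≤∑ f (suc i) = ≤-trans (term≤∑ (f ∘ suc) i) (m≤n+m _ (f zero))

∑-zero : ∀ {n} {f : Fin n → ℕ} → (∀ i → f i ≡ 0) → sum f ≡ 0
∑-zero {n} f≡0 = trans (sum-cong-≗ f≡0) (sum-replicate-zero n)

∑-ones : ∀ n → sum {n} (λ _ → 1) ≡ n
∑-ones zero    = refl
∑-ones (suc n) = cong suc (∑-ones n)

∑-split : ∀ m n (f : Fin (m + n) → ℕ) →
          sum f ≡ sum (λ i → f (i ↑ˡ n)) + sum (λ j → f (m ↑ʳ j))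
∑-split zero    n f = refl
∑-split (suc m) n f =
  trans (cong (f zero +_) (∑-split m n (f ∘ suc))) (sym (+-assoc (f zero) _ _))

count-single : ∀ {n} (a : Fin n) → sum (λ j → ind (a == j)) ≡ 1
count-single {suc n} zero    = cong suc (∑-zero {n} (λ j → refl))
count-single {suc n} (suc a) = count-single a

count-at : ∀ {n} b (a : Fin n) → sum (λ j → ind (b ∧ (a == j))) ≡ ind b
count-at true  a = count-single a
count-at {n} false a = ∑-zero {n} (λ j → refl)

count-pos : ∀ {n} (f : Fin n → Bool) i → f i ≡ true → 1 ≤ sum (ind ∘ f)
count-pos f i fi = ≤-trans (≤-reflexive (cong ind (sym fi))) (term≤∑ (ind ∘ f) i)

count-witness : ∀ {n} (f : Fin n → Bool) → 1 ≤ sum (ind ∘ f) → ∃ λ i → f i ≡ true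
count-witness {n} f pos with anyᵇ f in some
... | true  = anyᵇ-elim f some
... | false = ⊥-elim (1+n≰n (≤-trans pos (≤-reflexive (∑-zero {n} (cong ind ∘ anyᵇ-none f some)))))

Within : ℕ → ℕ → Set
Within k d = 1 ≤ d × d ≤ k

sum-tabulate : ∀ {n} (f : Fin n → ℕ) → ListAction.sum (tabulate f) ≡ sum f
sum-tabulate {zero}  f = refl
sum-tabulate {suc n} f = cong (f zero +_) (sum-tabulate (f ∘ suc))

deg≡∑ : ∀ {n} (A : Adj n) v → deg A v ≡ sum (λ u → ind (A v u))
deg≡∑ {n} A v = trans (cong ListAction.sum (map-tabulate id (λ u → ind (A v u)))) (sum-tabulate {n} _)

maximum : ∀ {n} → (Fin n → ℕ) → ℕ
maximum f = foldr _⊔_ 0 (tabulate f)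

term≤maximum : ∀ {n} (f : Fin n → ℕ) i → f i ≤ maximum f
term≤maximum f zero    = m≤m⊔n _ _
term≤maximum f (suc i) = ≤-trans (term≤maximum (f ∘ suc) i) (m≤n⊔m (f zero) _)

maximum≤ : ∀ {n} (f : Fin n → ℕ) {b} → (∀ i → f i ≤ b) → maximum f ≤ b
maximum≤ {zero}  f f≤b = z≤n
maximum≤ {suc n} f f≤b = ⊔-lub (f≤b zero) (maximum≤ (f ∘ suc) (f≤b ∘ suc))

maxDeg≡maximum : ∀ {n} (A : Adj n) → maxDeg A ≡ maximum (deg A)
maxDeg≡maximum A = cong (foldr _⊔_ 0) (map-tabulate id (deg A))

deg≤maxDeg : ∀ {n} (A : Adj n) v → deg A v ≤ maxDeg A
deg≤maxDeg A v = subst (deg A v ≤_) (sym (maxDeg≡maximum A)) (term≤maximum (deg A) v)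

maxDeg≤ : ∀ {n} (A : Adj n) {b} → (∀ v → deg A v ≤ b) → maxDeg A ≤ b
maxDeg≤ A deg≤b = subst (_≤ _) (sym (maxDeg≡maximum A)) (maximum≤ (deg A) deg≤b)

-- A spanning tree of A rooted at w, given by parent pointers that strictly decrease a
-- bounded depth; the bound is what lets us recurse from the leaves towards the root.
record RootedTree {n} (A : Adj n) (w : Fin n) : Set where
  field
    parent       : Fin n → Fin n
    depth        : Fin n → ℕ
    height       : ℕ
    depth≤height : ∀ u → depth u ≤ height
    parent-step  : ∀ u → u ≢ w → A u (parent u) ≡ true × depth u ≡ suc (depth (parent u))

-- The least L ≤ B satisfying P (or B if there is none).
least : (ℕ → Bool) → ℕ → ℕ
least P zero    = 0
least P (suc B) = if P 0 then 0 else suc (least (P ∘ suc) B)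

least-sat : ∀ (P : ℕ → Bool) B L → P L ≡ true → L ≤ B → P (least P B) ≡ true
least-sat P zero    zero    PL z≤n = PL
least-sat P (suc B) zero    PL _   rewrite PL = PL
least-sat P (suc B) (suc L) PL (s≤s L≤B) with P 0 in P0
... | true  = P0
... | false = least-sat (P ∘ suc) B L PL L≤B

least-min : ∀ (P : ℕ → Bool) B L → L < least P B → P L ≡ false
least-min P (suc B) L       L< with P 0 in P0
least-min P (suc B) zero    L<       | false = P0
least-min P (suc B) (suc L) (s≤s L<) | false = least-min (P ∘ suc) B L L<

least≤ : ∀ (P : ℕ → Bool) B → least P B ≤ B
least≤ P zero = z≤n
least≤ P (suc B) with P 0
... | true  = z≤n
... | false = s≤s (least≤ (P ∘ suc) B)

-- Breadth-first search from w: depth u is the distance from u to w.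
module BreadthFirst {n} (A : Adj n) (conn : Connected A) (w : Fin n) where

  reach : ℕ → Fin n → Bool
  reach zero    u = u == w
  reach (suc L) u = reach L u ∨ anyᵇ (λ v → A u v ∧ reach L v)

  reach-step : ∀ L {u v} → A u v ≡ true → reach L v ≡ true → reach (suc L) u ≡ true
  reach-step L {u} {v} uv rv with reach L u
  ... | true  = refl
  ... | false = anyᵇ-intro (λ v → A u v ∧ reach L v) v (cong₂ _∧_ uv rv)

  length : ∀ {u v} → Walk A u v → ℕ
  length here       = 0
  length (step _ W) = suc (length W)

  walk-reach : ∀ {u} (W : Walk A u w) → reach (length W) u ≡ true
  walk-reach here       = ==-refl w
  walk-reach (step e W) = reach-step (length W) e (walk-reach W)

  -- Every vertex reaches w within height steps, along the walk given by connectivity.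
  height : ℕ
  height = maximum (λ u → length (conn u w))

  depth : Fin n → ℕ
  depth u = least (λ L → reach L u) height

  depth-reach : ∀ u → reach (depth u) u ≡ true
  depth-reach u = least-sat (λ L → reach L u) height _ (walk-reach (conn u w))
                    (term≤maximum (λ u → length (conn u w)) u)

  depth≤ : ∀ {L u} → reach L u ≡ true → depth u ≤ L
  depth≤ {L} {u} rL =
    ≮⇒≥ (λ L<d → true≢false (trans (sym rL) (least-min (λ L → reach L u) height L L<d)))

  closer : ∀ u → u ≢ w → ∃ λ v → A u v ≡ true × depth u ≡ suc (depth v)
  closer u u≢w with depth u in du | depth-reach u
  ... | zero  | r0 = ⊥-elim (u≢w (witness (u ≟ w) r0))
  ... | suc d | rd = v , uv , cong suc (≤-antisym d≤dv (depth≤ rv))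
    where
    not-d : reach d u ≡ false
    not-d = least-min (λ L → reach L u) height d (≤-reflexive (sym du))
    step-closer : ∃ λ v → A u v ∧ reach d v ≡ true
    step-closer = anyᵇ-elim (λ v → A u v ∧ reach d v)
                    (subst (λ b → b ∨ anyᵇ (λ v → A u v ∧ reach d v) ≡ true) not-d rd)
    v : Fin n
    v = proj₁ step-closer
    uv : A u v ≡ true
    uv = proj₁ (∧-elim (proj₂ step-closer))
    rv : reach d v ≡ true
    rv = proj₂ (∧-elim {A u v} (proj₂ step-closer))
    d≤dv : d ≤ depth v
    d≤dv = ≤-pred (subst (_≤ suc (depth v)) du (depth≤ (reach-step (depth v) uv (depth-reach v))))

  parent : Fin n → Fin n
  parent u with u ≟ w
  ... | yes _   = w
  ... | no u≢w  = proj₁ (closer u u≢w)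

  tree : RootedTree A w
  tree = record
    { parent       = parent
    ; depth        = depth
    ; height       = height
    ; depth≤height = λ u → least≤ (λ L → reach L u) height
    ; parent-step  = parent-step
    }
    where
    parent-step : ∀ u → u ≢ w → A u (parent u) ≡ true × depth u ≡ suc (depth (parent u))
    parent-step u u≢w with u ≟ w
    ... | yes u≡w = ⊥-elim (u≢w u≡w)
    ... | no u≢w  = proj₂ (closer u u≢w)

bfs-tree : ∀ {n} (A : Adj n) → Connected A → (w : Fin n) → RootedTree A w
bfs-tree A conn w = BreadthFirst.tree A conn w

-- The greedy cover of a rooted tree, built from the leaves towards the root: a non-root
-- vertex climbs (keeps the edge to its parent) exactly when no child climbs to it.  So a
-- climbing vertex has degree 1, and any other vertex meets only edges to its children,
-- at least one of them unless it is the root.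
module GreedyCover {n} (A : Adj n) (symA : ∀ i j → A i j ≡ A j i) (w : Fin n)
                   (τ : RootedTree A w) where
  open RootedTree τ

  below-parent : ∀ u → u ≢ w → depth (parent u) < depth u
  below-parent u u≢w = ≤-reflexive (sym (proj₂ (parent-step u u≢w)))

  parent-acyclic : ∀ {x y} → x ≢ w → y ≢ w → parent x ≡ y → parent y ≢ x
  parent-acyclic {x} x≢w px≢w refl ppx≡x =
    <-asym (below-parent x x≢w)
           (subst (λ z → depth z < depth (parent x)) ppx≡x (below-parent (parent x) px≢w))

  needy : ℕ → Fin n → Bool
  needy zero    u = true
  needy (suc f) u = not (anyᵇ (λ c → (not (c == w) ∧ needy f c) ∧ (parent c == u)))

  -- Fuel suc (height ∸ depth u) suffices: each level down the tree costs one unit.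
  needs : Fin n → Bool
  needs u = needy (suc (height ∸ depth u)) u

  climbs : Fin n → Bool
  climbs c = not (c == w) ∧ needs c

  climbsTo : Fin n → Fin n → Bool
  climbsTo c u = climbs c ∧ (parent c == u)

  climbs-root : climbs w ≡ false
  climbs-root = cong (λ b → not b ∧ needs w) (==-refl w)

  climbs-nonroot : ∀ x → x ≢ w → climbs x ≡ needs x
  climbs-nonroot x x≢w = cong (λ b → not b ∧ needs x) (dec-false (x ≟ w) x≢w)

  climbsTo-parent : ∀ {c u} → climbsTo c u ≡ true → c ≢ w × parent c ≡ u
  climbsTo-parent {c} {u} cu =
    unequal (proj₁ (∧-elim (proj₁ (∧-elim cu)))) , witness (parent c ≟ u) (proj₂ (∧-elim {climbs c} cu))

  climbsTo-adj : ∀ {c u} → climbsTo c u ≡ true → A c u ≡ true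
  climbsTo-adj {c} cu with climbsTo-parent cu
  ... | c≢w , refl = proj₁ (parent-step c c≢w)

  fuel-step : ∀ c → c ≢ w → height ∸ depth (parent c) ≡ suc (height ∸ depth c)
  fuel-step c c≢w = begin
    height ∸ depth (parent c)              ≡⟨ +-∸-assoc 1 (subst (_≤ height) dc (depth≤height c)) ⟩
    suc (height ∸ suc (depth (parent c)))  ≡⟨ cong (λ d → suc (height ∸ d)) (sym dc) ⟩
    suc (height ∸ depth c)                 ∎
    where
    open ≡-Reasoning
    dc = proj₂ (parent-step c c≢w)

  needs-unfold : ∀ u → needs u ≡ not (anyᵇ (λ c → climbsTo c u))
  needs-unfold u = cong not (anyᵇ-cong enough-fuel)
    where
    enough-fuel : ∀ c → (not (c == w) ∧ needy (height ∸ depth u) c) ∧ (parent c == u)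
                        ≡ climbsTo c u
    enough-fuel c with c ≟ w | parent c ≟ u
    ... | yes _   | _        = refl
    ... | no _    | no _     = trans (∧-zeroʳ _) (sym (∧-zeroʳ _))
    ... | no c≢w  | yes refl = cong (λ f → needy f c ∧ true) (fuel-step c c≢w)

  cover : Adj n
  cover x y = climbsTo y x ∨ climbsTo x y

  cover-spanning : IsSpanningSubgraph cover A
  cover-spanning = (λ x y → ∨-comm (climbsTo y x) (climbsTo x y)) , edge
    where
    edge : ∀ x y → cover x y ≡ true → A x y ≡ true
    edge x y e with climbsTo y x in yx
    ... | true  = trans (symA x y) (climbsTo-adj yx)
    ... | false = climbsTo-adj e

  down : Fin n → ℕ
  down x = sum (λ y → ind (climbsTo y x))

  deg-cover : ∀ x → deg cover x ≡ down x + ind (climbs x)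
  deg-cover x = begin
    deg cover x                                          ≡⟨ deg≡∑ cover x ⟩
    sum (λ y → ind (climbsTo y x ∨ climbsTo x y))        ≡⟨ sum-cong-≗ {n} (λ y → ind-∨ _ _ exclusive) ⟩
    sum (λ y → ind (climbsTo y x) + ind (climbsTo x y))  ≡⟨ ∑-distrib-+ {n} _ _ ⟩
    down x + sum (λ y → ind (climbsTo x y))              ≡⟨ cong (down x +_) (count-at (climbs x) (parent x)) ⟩
    down x + ind (climbs x)                              ∎
    where
    open ≡-Reasoning
    exclusive : ∀ {y} → climbsTo y x ≡ true → climbsTo x y ≡ true → ⊥
    exclusive yx xy with climbsTo-parent yx | climbsTo-parent xy
    ... | y≢w , py≡x | x≢w , px≡y = parent-acyclic x≢w y≢w px≡y py≡x

  down≤deg : ∀ x → down x ≤ deg A x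
  down≤deg x = subst (down x ≤_) (sym (deg≡∑ A x))
                 (∑-mono (λ y → ind-mono (λ yx → trans (symA x y) (climbsTo-adj yx))))

  suc-down≤deg : ∀ x → x ≢ w → suc (down x) ≤ deg A x
  suc-down≤deg x x≢w = begin
    suc (down x)                                          ≡⟨ +-comm 1 (down x) ⟩
    down x + 1                                            ≡⟨ cong (down x +_) (sym (count-single (parent x))) ⟩
    down x + sum (λ y → ind (parent x == y))              ≡⟨ sym (∑-distrib-+ {n} _ _) ⟩
    sum (λ y → ind (climbsTo y x) + ind (parent x == y))  ≤⟨ ∑-mono neighbour ⟩
    sum (λ y → ind (A x y))                               ≡⟨ sym (deg≡∑ A x) ⟩
    deg A x                                               ∎
    where
    open ≤-Reasoning
    neighbour : ∀ y → ind (climbsTo y x) + ind (parent x == y) ≤ ind (A x y)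
    neighbour y = begin
      ind (climbsTo y x) + ind (parent x == y)  ≡⟨ sym (ind-∨ _ _ exclusive) ⟩
      ind (climbsTo y x ∨ (parent x == y))      ≤⟨ ind-mono adjacent ⟩
      ind (A x y)                               ∎
      where
      exclusive : climbsTo y x ≡ true → (parent x == y) ≡ true → ⊥
      exclusive yx px with climbsTo-parent yx
      ... | y≢w , py≡x = parent-acyclic x≢w y≢w (witness (parent x ≟ y) px) py≡x
      adjacent : climbsTo y x ∨ (parent x == y) ≡ true → A x y ≡ true
      adjacent e with climbsTo y x in yx
      ... | true  = trans (symA x y) (climbsTo-adj yx)
      ... | false = subst (λ z → A x z ≡ true) (witness (parent x ≟ y) e) (proj₁ (parent-step x x≢w))

  down-needs : ∀ x → needs x ≡ true → down x ≡ 0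
  down-needs x nx = ∑-zero {n} (λ y → cong ind (anyᵇ-none _ none y))
    where
    none : anyᵇ (λ c → climbsTo c x) ≡ false
    none = not-true (trans (sym (needs-unfold x)) nx)
      where not-true : ∀ {b} → not b ≡ true → b ≡ false
            not-true {false} _ = refl

  down-satisfied : ∀ x → needs x ≡ false → 1 ≤ down x
  down-satisfied x nx = let c , cx = anyᵇ-elim _ some in count-pos (λ y → climbsTo y x) c cx
    where
    some : anyᵇ (λ c → climbsTo c x) ≡ true
    some = not-false (trans (sym (needs-unfold x)) nx)
      where not-false : ∀ {b} → not b ≡ false → b ≡ true
            not-false {true} _ = refl

  covered : ∀ x → x ≢ w → 1 ≤ deg cover x
  covered x x≢w = by-needs (needs x) refl
    where
    open ≤-Reasoning
    by-needs : ∀ b → needs x ≡ b → 1 ≤ deg cover x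
    by-needs true nx = begin
      1                        ≡⟨ cong ind (sym (trans (climbs-nonroot x x≢w) nx)) ⟩
      ind (climbs x)           ≤⟨ m≤n+m _ (down x) ⟩
      down x + ind (climbs x)  ≡⟨ sym (deg-cover x) ⟩
      deg cover x              ∎
    by-needs false nx = begin
      1                        ≤⟨ down-satisfied x nx ⟩
      down x                   ≤⟨ m≤m+n _ _ ⟩
      down x + ind (climbs x)  ≡⟨ sym (deg-cover x) ⟩
      deg cover x              ∎

  root-bounded : ∀ {k} → deg A w ≤ k → deg cover w ≤ k
  root-bounded {k} dw≤k = begin
    deg cover w              ≡⟨ deg-cover w ⟩
    down w + ind (climbs w)  ≡⟨ cong (λ b → down w + ind b) climbs-root ⟩
    down w + 0               ≡⟨ +-identityʳ _ ⟩
    down w                   ≤⟨ down≤deg w ⟩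
    deg A w                  ≤⟨ dw≤k ⟩
    k                        ∎
    where open ≤-Reasoning

  -- A non-root vertex has degree 1 if it climbs, and otherwise fewer climbing children
  -- than neighbours.
  nonroot-bounded : ∀ {k} → 1 ≤ k → (∀ v → deg A v ≤ suc k) → ∀ x → x ≢ w → deg cover x ≤ k
  nonroot-bounded {k} 1≤k d≤k+1 x x≢w = by-needs (needs x) refl
    where
    open ≤-Reasoning
    by-needs : ∀ b → needs x ≡ b → deg cover x ≤ k
    by-needs true nx = begin
      deg cover x              ≡⟨ deg-cover x ⟩
      down x + ind (climbs x)  ≡⟨ cong₂ (λ d b → d + ind b) (down-needs x nx) (trans (climbs-nonroot x x≢w) nx) ⟩
      1                        ≤⟨ 1≤k ⟩
      k                        ∎
    by-needs false nx = ≤-pred (begin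
      suc (deg cover x)              ≡⟨ cong suc (deg-cover x) ⟩
      suc (down x + ind (climbs x))  ≡⟨ cong (λ b → suc (down x + ind b)) (trans (climbs-nonroot x x≢w) nx) ⟩
      suc (down x + 0)               ≡⟨ cong suc (+-identityʳ _) ⟩
      suc (down x)                   ≤⟨ suc-down≤deg x x≢w ⟩
      deg A x                        ≤⟨ d≤k+1 x ⟩
      suc k                          ∎)

  bounded : ∀ k → 1 ≤ k → deg A w ≤ k → (∀ v → deg A v ≤ suc k) → ∀ x → deg cover x ≤ k
  bounded k 1≤k dw≤k d≤k+1 x = by-root (x ≟ w)
    where
    by-root : Dec (x ≡ w) → deg cover x ≤ k
    by-root (yes x≡w) = subst (λ z → deg cover z ≤ k) (sym x≡w) (root-bounded dw≤k)
    by-root (no x≢w)  = nonroot-bounded 1≤k d≤k+1 x x≢w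

star-cover : ∀ {n} (A : Adj n) → (∀ i j → A i j ≡ A j i) → Connected A → (w : Fin n) →
             ∀ k → 1 ≤ k → deg A w ≤ k → (∀ v → deg A v ≤ suc k) →
             Σ (Adj n) λ H → IsSpanningSubgraph H A × (∀ x → x ≢ w → 1 ≤ deg H x)
                                                   × (∀ x → deg H x ≤ k)
star-cover A symA conn w k 1≤k dw≤k d≤k+1 =
  cover , cover-spanning , covered , bounded k 1≤k dw≤k d≤k+1
  where open GreedyCover A symA w (bfs-tree A conn w)

-- The tree T = T₁ ∘ K_{1,p}

-- A vertex of T is a vertex inj₁ i of T₁ or a vertex inj₂ j of the star: inj₂ zero is the
-- centre, inj₂ (suc j) the p − 1 new leaves.
module Attached {n} (p' : ℕ) (A : Adj n) (w : Fin n) where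

  p : ℕ
  p = suc p'

  V : Set
  V = Fin n ⊎ Fin p

  vertex : V → Fin (n + p)
  vertex = join n p

  centre : V
  centre = inj₂ zero

  every-vertex : (P : Fin (n + p) → Set) → (∀ a → P (vertex a)) → ∀ x → P x
  every-vertex P P-vertex x = subst P (join-splitAt n p x) (P-vertex (splitAt n x))

  T : Adj (n + p)
  T = attachStar A w p

  deg-split : (G : Adj (n + p)) (a : V) →
              deg G (vertex a) ≡ sum (λ i → ind (G (vertex a) (vertex (inj₁ i))))
                               + sum (λ j → ind (G (vertex a) (vertex (inj₂ j))))
  deg-split G a = trans (deg≡∑ G (vertex a)) (∑-split n p (λ y → ind (G (vertex a) y)))

  extendAdj : Adj n → Bool → V → V → Bool
  extendAdj H e (inj₁ i)       (inj₁ j)       = H i j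
  extendAdj H e (inj₁ i)       (inj₂ zero)    = e ∧ (i == w)
  extendAdj H e (inj₂ zero)    (inj₁ j)       = e ∧ (j == w)
  extendAdj H e (inj₂ zero)    (inj₂ (suc _)) = true
  extendAdj H e (inj₂ (suc _)) (inj₂ zero)    = true
  extendAdj H e _              _              = false

  extend : Adj n → Bool → Adj (n + p)
  extend H e x y = extendAdj H e (splitAt n x) (splitAt n y)

  star : V → V → Bool
  star = extendAdj A true

  attach≡star : ∀ a b → attachAdj A w a b ≡ star a b
  attach≡star (inj₁ i) (inj₂ zero) with i ≟ w
  ... | yes _ = refl
  ... | no _  = refl
  attach≡star (inj₂ zero) (inj₁ j) with j ≟ w
  ... | yes _ = refl
  ... | no _  = refl
  attach≡star (inj₁ _)       (inj₁ _)       = refl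
  attach≡star (inj₁ _)       (inj₂ (suc _)) = refl
  attach≡star (inj₂ zero)    (inj₂ zero)    = refl
  attach≡star (inj₂ zero)    (inj₂ (suc _)) = refl
  attach≡star (inj₂ (suc _)) (inj₁ _)       = refl
  attach≡star (inj₂ (suc _)) (inj₂ zero)    = refl
  attach≡star (inj₂ (suc _)) (inj₂ (suc _)) = refl

  T-vertex : ∀ a b → T (vertex a) (vertex b) ≡ star a b
  T-vertex a b = trans (cong₂ (attachAdj A w) (splitAt-join n p a) (splitAt-join n p b))
                       (attach≡star a b)

  deg-T : ∀ x → deg T x ≡ deg (extend A true) x
  deg-T x = trans (deg≡∑ T x)
    (trans (sum-cong-≗ {n + p} (λ y → cong ind (attach≡star (splitAt n x) (splitAt n y))))
           (sym (deg≡∑ (extend A true) x)))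

  extend-vertex : ∀ H e a b → extend H e (vertex a) (vertex b) ≡ extendAdj H e a b
  extend-vertex H e a b = cong₂ (extendAdj H e) (splitAt-join n p a) (splitAt-join n p b)

  deg-extend : ∀ H e a → deg (extend H e) (vertex a)
                         ≡ sum (λ i → ind (extendAdj H e a (inj₁ i))) + sum (λ j → ind (extendAdj H e a (inj₂ j)))
  deg-extend H e a = trans (deg-split (extend H e) a)
    (cong₂ _+_ (sum-cong-≗ {n} (λ i → cong ind (extend-vertex H e a (inj₁ i))))
               (sum-cong-≗ {p} (λ j → cong ind (extend-vertex H e a (inj₂ j)))))

  deg-extend-old : ∀ H e i → deg (extend H e) (vertex (inj₁ i)) ≡ deg H i + ind (e ∧ (i == w))
  deg-extend-old H e i = begin
    deg (extend H e) (vertex (inj₁ i))                                ≡⟨ deg-extend H e (inj₁ i) ⟩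
    sum (λ j → ind (H i j)) + (ind (e ∧ (i == w)) + sum {p'} (λ _ → 0))  ≡⟨ cong₂ _+_ (sym (deg≡∑ H i))
                                                                              (cong (ind (e ∧ (i == w)) +_) (∑-zero {p'} (λ _ → refl))) ⟩
    deg H i + (ind (e ∧ (i == w)) + 0)                                 ≡⟨ cong (deg H i +_) (+-identityʳ _) ⟩
    deg H i + ind (e ∧ (i == w))                                       ∎
    where open ≡-Reasoning

  deg-extend-centre : ∀ H e → deg (extend H e) (vertex centre) ≡ ind e + p'
  deg-extend-centre H e = trans (deg-extend H e centre)
    (cong₂ _+_ (trans (sum-cong-≗ {n} (λ j → cong (λ b → ind (e ∧ b)) (==-sym j w))) (count-at e w)) (∑-ones p'))

  deg-extend-leaf : ∀ H e j → deg (extend H e) (vertex (inj₂ (suc j))) ≡ 1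
  deg-extend-leaf H e j = trans (deg-extend H e (inj₂ (suc j)))
                                (cong₂ (λ a b → a + suc b) (∑-zero {n} (λ _ → refl)) (∑-zero {p'} (λ _ → refl)))

  extend-spanning : ∀ H e → IsSpanningSubgraph H A → IsSpanningSubgraph (extend H e) T
  extend-spanning H e (symH , H⊆A) =
    (λ x y → symmetric (splitAt n x) (splitAt n y)) ,
    (λ x y e → trans (attach≡star (splitAt n x) (splitAt n y)) (inside (splitAt n x) (splitAt n y) e))
    where
    symmetric : ∀ a b → extendAdj H e a b ≡ extendAdj H e b a
    symmetric (inj₁ i)       (inj₁ j)       = symH i j
    symmetric (inj₁ _)       (inj₂ zero)    = refl
    symmetric (inj₁ _)       (inj₂ (suc _)) = refl
    symmetric (inj₂ zero)    (inj₁ _)       = refl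
    symmetric (inj₂ zero)    (inj₂ zero)    = refl
    symmetric (inj₂ zero)    (inj₂ (suc _)) = refl
    symmetric (inj₂ (suc _)) (inj₁ _)       = refl
    symmetric (inj₂ (suc _)) (inj₂ zero)    = refl
    symmetric (inj₂ (suc _)) (inj₂ (suc _)) = refl
    inside : ∀ a b → extendAdj H e a b ≡ true → star a b ≡ true
    inside (inj₁ i)       (inj₁ j)       ab = H⊆A i j ab
    inside (inj₁ i)       (inj₂ zero)    ab = proj₂ (∧-elim {e} ab)
    inside (inj₂ zero)    (inj₁ j)       ab = proj₂ (∧-elim {e} ab)
    inside (inj₂ zero)    (inj₂ (suc _)) ab = refl
    inside (inj₂ (suc _)) (inj₂ zero)    ab = refl

  -- Δ(T) = max(Δ(T₁), p): the degree of w grows by one, which stays below Δ(T₁) as w ∈ B(T₁).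
  maxDeg-T : InB A w → maxDeg T ≡ maxDeg A ⊔ p
  maxDeg-T w∈B = ≤-antisym (maxDeg≤ T (every-vertex _ bound)) (⊔-lub (maxDeg≤ A old≤) centre≤)
    where
    old≤ : ∀ i → deg A i ≤ maxDeg T
    old≤ i = begin
      deg A i                             ≤⟨ m≤m+n _ _ ⟩
      deg A i + ind (true ∧ (i == w))     ≡⟨ sym (trans (deg-T (vertex (inj₁ i))) (deg-extend-old A true i)) ⟩
      deg T (vertex (inj₁ i))             ≤⟨ deg≤maxDeg T _ ⟩
      maxDeg T                            ∎
      where open ≤-Reasoning
    centre≤ : p ≤ maxDeg T
    centre≤ = subst (_≤ maxDeg T) (trans (deg-T (vertex centre)) (deg-extend-centre A true))
                    (deg≤maxDeg T (vertex centre))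
    old-bound : ∀ i → deg A i + ind (i == w) ≤ maxDeg A
    old-bound i with i ≟ w
    ... | yes i≡w = subst (λ v → deg A v + 1 ≤ maxDeg A) (sym i≡w) (subst (_≤ maxDeg A) (+-comm 1 _) w∈B)
    ... | no _    = subst (_≤ maxDeg A) (sym (+-identityʳ _)) (deg≤maxDeg A i)
    bound : ∀ a → deg T (vertex a) ≤ maxDeg A ⊔ p
    bound a = ≤-trans (≤-reflexive (deg-T (vertex a))) (by-part a)
      where
      by-part : ∀ a → deg (extend A true) (vertex a) ≤ maxDeg A ⊔ p
      by-part (inj₁ i)       = ≤-trans (≤-reflexive (deg-extend-old A true i)) (≤-trans (old-bound i) (m≤m⊔n _ _))
      by-part (inj₂ zero)    = ≤-trans (≤-reflexive (deg-extend-centre A true)) (m≤n⊔m _ _)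
      by-part (inj₂ (suc j)) = ≤-trans (≤-reflexive (deg-extend-leaf A true j)) (≤-trans (s≤s z≤n) (m≤n⊔m (maxDeg A) p))

  extend-admissible : ∀ H e {k} → IsSpanningSubgraph H A → 1 ≤ p' →
                      (∀ i → Within k (deg H i + ind (e ∧ (i == w)))) → ind e + p' ≤ k →
                      Admissible T k
  extend-admissible H e {k} span 1≤p' old-ok centre≤k =
    extend H e , extend-spanning H e span , every-vertex _ by-part
    where
    1≤centre : 1 ≤ ind e + p'
    1≤centre = ≤-trans 1≤p' (m≤n+m p' (ind e))
    by-part : ∀ a → Within k (deg (extend H e) (vertex a))
    by-part (inj₁ i)       = subst (Within k) (sym (deg-extend-old H e i)) (old-ok i)
    by-part (inj₂ zero)    = subst (Within k) (sym (deg-extend-centre H e)) (1≤centre , centre≤k)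
    by-part (inj₂ (suc j)) = subst (Within k) (sym (deg-extend-leaf H e j))
                                   (≤-refl , ≤-trans 1≤centre centre≤k)

  -- sp(T) ≤ max(sp(T₁), p − 1): keep an admissible subgraph of T₁ and the edges to the leaves.
  admissible-keep : 1 ≤ p' → ∀ {k} → Admissible A k → Admissible T (k ⊔ p')
  admissible-keep 1≤p' {k} (H , span , ok) =
    extend-admissible H false span 1≤p' old (m≤n⊔m k p')
    where
    old : ∀ i → Within (k ⊔ p') (deg H i + 0)
    old i = subst (Within (k ⊔ p')) (sym (+-identityʳ _))
                  (proj₁ (ok i) , ≤-trans (proj₂ (ok i)) (m≤m⊔n k p'))

  -- A spanning subgraph of T₁ of maximum degree ≤ k covering every vertex but possibly w
  -- extends to an admissible subgraph of T when p ≤ k: join w to the centre iff w is uncovered.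
  admissible-from-cover : 1 ≤ p' → ∀ {k} → p ≤ k → (H : Adj n) → IsSpanningSubgraph H A →
                          (∀ x → x ≢ w → 1 ≤ deg H x) → (∀ x → deg H x ≤ k) → Admissible T k
  admissible-from-cover 1≤p' {k} p≤k H span covers bounded = by-deg-w (deg H w) refl
    where
    by-deg-w : ∀ d → deg H w ≡ d → Admissible T k
    by-deg-w zero w-uncovered = extend-admissible H true span 1≤p' old p≤k
      where
      old : ∀ i → Within k (deg H i + ind (i == w))
      old i with i ≟ w
      ... | yes i≡w = m≤n+m 1 (deg H i) ,
                      subst (λ d → d + 1 ≤ k) (sym (trans (cong (deg H) i≡w) w-uncovered))
                            (≤-trans (s≤s z≤n) p≤k)
      ... | no i≢w  = subst (Within k) (sym (+-identityʳ _)) (covers i i≢w , bounded i)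
    by-deg-w (suc d) w-covered = extend-admissible H false span 1≤p' old (≤-trans (n≤1+n p') p≤k)
      where
      covered : ∀ i → 1 ≤ deg H i
      covered i with i ≟ w
      ... | yes i≡w = subst (1 ≤_) (sym (trans (cong (deg H) i≡w) w-covered)) (s≤s z≤n)
      ... | no i≢w  = covers i i≢w
      old : ∀ i → Within k (deg H i + 0)
      old i = subst (Within k) (sym (+-identityʳ _)) (covered i , bounded i)

  -- If p < Δ(T₁) then sp(T) ≤ Δ(T₁) − 1, using the greedy star cover of T₁.
  admissible-below-Δ : (∀ i j → A i j ≡ A j i) → Connected A → InB A w → 1 ≤ p' → p < maxDeg A →
                       Σ ℕ λ k → suc k ≡ maxDeg A × Admissible T k
  admissible-below-Δ symA conn w∈B 1≤p' p<Δ =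
    k , k+1≡Δ , admissible-from-cover 1≤p' p≤k H span covers bounded
    where
    k = pred (maxDeg A)
    k+1≡Δ : suc k ≡ maxDeg A
    k+1≡Δ = suc-pred (maxDeg A) {{>-nonZero (≤-<-trans z≤n w∈B)}}
    p≤k : p ≤ k
    p≤k = <⇒≤pred p<Δ
    cover = star-cover A symA conn w k (≤-trans (s≤s z≤n) p≤k) (<⇒≤pred w∈B)
              (λ v → subst (deg A v ≤_) (sym k+1≡Δ) (deg≤maxDeg A v))
    H = proj₁ cover
    span = proj₁ (proj₂ cover)
    covers = proj₁ (proj₂ (proj₂ cover))
    bounded = proj₂ (proj₂ (proj₂ cover))

  leaf-neighbour : ∀ {j} b → star (inj₂ (suc j)) b ≡ true → b ≡ centre
  leaf-neighbour (inj₂ zero) _ = refl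

  bridge : ∀ i j → star (inj₁ i) (inj₂ j) ≡ true → i ≡ w × j ≡ zero
  bridge i zero e = witness (i ≟ w) e , refl

  -- An admissible subgraph of T either keeps the edge between the centre and w, and then the
  -- centre also keeps all p − 1 leaves, or it has no edge between T₁ and the star and
  -- restricts to an admissible subgraph of T₁.  Hence sp(T) ≥ min(sp(T₁), p).
  admissible-split : ∀ {k} → Admissible T k → p ≤ k ⊎ Admissible A k
  admissible-split {k} (H , (symH , H⊆T) , ok) = by-bridge (HV centre (inj₁ w)) refl
    where
    HV : V → V → Bool
    HV a b = H (vertex a) (vertex b)
    H⊆star : ∀ a b → HV a b ≡ true → star a b ≡ true
    H⊆star a b e = trans (sym (T-vertex a b)) (H⊆T _ _ e)
    leaf-kept : ∀ j → HV centre (inj₂ (suc j)) ≡ true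
    leaf-kept j = trans (symH (vertex centre) ℓ) (subst (λ z → H ℓ z ≡ true) y≡centre ℓy)
      where
      ℓ = vertex (inj₂ (suc j))
      y  = proj₁ (count-witness (H ℓ) (subst (1 ≤_) (deg≡∑ H ℓ) (proj₁ (ok ℓ))))
      ℓy = proj₂ (count-witness (H ℓ) (subst (1 ≤_) (deg≡∑ H ℓ) (proj₁ (ok ℓ))))
      y≡centre : y ≡ vertex centre
      y≡centre = trans (sym (join-splitAt n p y)) (cong vertex (leaf-neighbour (splitAt n y)
                   (H⊆star (inj₂ (suc j)) (splitAt n y) (subst (λ z → H ℓ z ≡ true) (sym (join-splitAt n p y)) ℓy))))
    by-bridge : ∀ b → HV centre (inj₁ w) ≡ b → p ≤ k ⊎ Admissible A k
    by-bridge true kept = inj₁ (begin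
      suc p'                                            ≡⟨ cong suc (sym (∑-ones p')) ⟩
      1 + sum {p'} (λ _ → 1)                             ≡⟨ cong suc (sum-cong-≗ {p'} (λ j → cong ind (sym (leaf-kept j)))) ⟩
      1 + sum (λ j → ind (HV centre (inj₂ (suc j))))     ≤⟨ +-mono-≤ (count-pos (λ i → HV centre (inj₁ i)) w kept) (m≤n+m _ _) ⟩
      sum (λ i → ind (HV centre (inj₁ i))) + sum (λ j → ind (HV centre (inj₂ j)))  ≡⟨ sym (deg-split H centre) ⟩
      deg H (vertex centre)                              ≤⟨ proj₂ (ok _) ⟩
      k                                                  ∎)
      where open ≤-Reasoning
    by-bridge false cut = inj₂ (H₁ , ((λ i j → symH _ _) , (λ i j e → H⊆star (inj₁ i) (inj₁ j) e)) , restricted-ok)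
      where
      H₁ : Adj n
      H₁ i j = HV (inj₁ i) (inj₁ j)
      no-bridge : ∀ i j → HV (inj₁ i) (inj₂ j) ≡ false
      no-bridge i j with HV (inj₁ i) (inj₂ j) in ij
      ... | false = refl
      ... | true with bridge i j (H⊆star (inj₁ i) (inj₂ j) ij)
      ...   | refl , refl = trans (sym (trans (symH _ _) ij)) cut
      restricted-ok : ∀ i → Within k (deg H₁ i)
      restricted-ok i = subst (Within k) deg-restricted (ok (vertex (inj₁ i)))
        where
        deg-restricted : deg H (vertex (inj₁ i)) ≡ deg H₁ i
        deg-restricted = begin
          deg H (vertex (inj₁ i))                                                       ≡⟨ deg-split H (inj₁ i) ⟩
          sum (λ j → ind (H₁ i j)) + sum (λ j → ind (HV (inj₁ i) (inj₂ j)))            ≡⟨ cong₂ _+_ (sym (deg≡∑ H₁ i)) (∑-zero {p} (λ j → cong ind (no-bridge i j))) ⟩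
          deg H₁ i + 0                                                                  ≡⟨ +-identityʳ _ ⟩
          deg H₁ i                                                                      ∎
          where open ≡-Reasoning

mainTheorem9 : (n p : ℕ) (T₁ : Adj n) → IsTree T₁ → 3 ≤ n → 2 ≤ p
    → (w : Fin n) → InB T₁ w
    → (s₁ s : ℕ) → IsSp T₁ s₁ → IsSp (attachStar T₁ w p) s
    → ((p < s₁ → s₁ ≡ maxDeg T₁ → s ≢ maxDeg (attachStar T₁ w p))
      × (p ≤ s₁ → s₁ < maxDeg T₁ → s ≢ maxDeg (attachStar T₁ w p))
      × (s₁ < p → s ≢ maxDeg (attachStar T₁ w p))
      × (p ≡ s₁ → s₁ ≡ maxDeg T₁ → s ≡ maxDeg (attachStar T₁ w p)))
mainTheorem9 n (suc p') T₁ ((symA , _) , conn , _) _ (s≤s 1≤p') w w∈B s₁ s (adm₁ , least₁) (admT , leastT) =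
    (λ p<s₁ s₁≡Δ₁ → below-Δ (<-≤-trans p<s₁ (≤-reflexive s₁≡Δ₁)))
  , (λ p≤s₁ s₁<Δ₁ → below-Δ (≤-<-trans p≤s₁ s₁<Δ₁))
  , (λ s₁<p → <⇒≢ (≤-<-trans s≤kept (subst (_< maxDeg T) (sym (m≤n⇒m⊔n≡n (≤-pred s₁<p))) p≤ΔT)))
  , at-Δ
  where
  open Attached p' T₁ w
  ΔT : maxDeg T ≡ maxDeg T₁ ⊔ p
  ΔT = maxDeg-T w∈B
  p≤ΔT : p ≤ maxDeg T
  p≤ΔT = ≤-trans (m≤n⊔m (maxDeg T₁) p) (≤-reflexive (sym ΔT))
  s≤kept : s ≤ s₁ ⊔ p'
  s≤kept = leastT _ (admissible-keep 1≤p' adm₁)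
  below-Δ : p < maxDeg T₁ → s ≢ maxDeg T
  below-Δ p<Δ₁ with admissible-below-Δ symA conn w∈B 1≤p' p<Δ₁
  ... | k , k+1≡Δ₁ , admk = <⇒≢ (≤-<-trans (leastT k admk)
                              (<-≤-trans (≤-reflexive k+1≡Δ₁) (≤-trans (m≤m⊔n _ p) (≤-reflexive (sym ΔT)))))
  at-Δ : p ≡ s₁ → s₁ ≡ maxDeg T₁ → s ≡ maxDeg T
  at-Δ p≡s₁ s₁≡Δ₁ = trans (≤-antisym upper lower) s₁≡ΔT
    where
    upper : s ≤ s₁
    upper = ≤-trans s≤kept (≤-reflexive (m≥n⇒m⊔n≡m (subst (p' ≤_) p≡s₁ (n≤1+n p'))))
    lower : s₁ ≤ s
    lower = [ subst (_≤ s) p≡s₁ , least₁ s ]′ (admissible-split admT)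
    s₁≡ΔT : s₁ ≡ maxDeg T
    s₁≡ΔT = sym (trans ΔT (trans (cong₂ _⊔_ (sym s₁≡Δ₁) p≡s₁) (⊔-idem s₁)))
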